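{- For every $n\ge 6$, $H_n(x)=xH_{n-2}(x)+xH_{n-3}(x)$.
   Context: For $n\ge 0$, the $S$-fence $\phi_n$ is the poset on $\{x_1,\dots,x_n\}$ whose order is generated by the cover relations $x_2<x_1$, $x_3<x_2$, $x_2<x_4$, $x_5<x_4$, and, for every $i\ge 3$, $x_{2i-1}<x_{2i}$ and $x_{2i+1}<x_{2i}$, keeping only those relations whose elements both have index $\le n$. A filter is an up-set. $\Phi_n$ is the underlying undirected graph of the Hasse diagram of the lattice of filters of $\phi_n$ ordered by reverse inclusion (two filters adjacent iff they differ in exactly one element). A maximal $k$-dimensional cube of $\Phi_n$ is an induced subgraph isomorphic to the hypercube $Q_k$ not contained in any induced hypercube subgraph of larger dimension; $h_{n,k}$ is their number and $H_n(x)=\sum_{k\ge0}h_{n,k}x^k$ is the maximal cube polynomial. -}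

module Defs where

open import Data.Nat using (ℕ; zero; suc; _+_; _*_; _∸_; _≤_; _<_)
open import Data.Bool using (Bool; true; false; _≟_)
open import Data.Fin using (Fin; toℕ)
open import Data.Fin.Subset using (Subset; _∈_)
open import Data.Vec using (Vec; []; _∷_)
open import Data.Product using (Σ; ∃; _×_; _,_)
open import Relation.Nullary using (¬_; yes; no)
open import Relation.Binary.PropositionalEquality using (_≡_)
open import Relation.Binary.Construct.Closure.ReflexiveTransitive using (Star)
open import Function.Bundles using (_⇔_)

-- Generating cover relations of the S-fence, on paper indices (x_i ↦ i).
-- Cover i j  means  x_i < x_j  (x_i is below x_j).
data Cover : ℕ → ℕ → Set where
  c21  : Cover 2 1
  c32  : Cover 3 2
  c24  : Cover 2 4
  c54  : Cover 5 4
  codd : ∀ i → 3 ≤ i → Cover (2 * i ∸ 1) (2 * i)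
  ceve : ∀ i → 3 ≤ i → Cover (suc (2 * i)) (2 * i)

-- Element a : Fin n of φ_n stands for x_{toℕ a + 1}; only relations between
-- elements with index ≤ n are kept (automatic since both ends are in Fin n).
Cov : (n : ℕ) → Fin n → Fin n → Set
Cov n a b = Cover (suc (toℕ a)) (suc (toℕ b))

_≤φ_ : {n : ℕ} → Fin n → Fin n → Set
_≤φ_ {n} = Star (Cov n)

IsFilter : (n : ℕ) → Subset n → Set
IsFilter n F = ∀ a b → a ≤φ b → a ∈ F → b ∈ F

dist : {m : ℕ} → Vec Bool m → Vec Bool m → ℕ
dist [] [] = 0
dist (x ∷ xs) (y ∷ ys) with x ≟ y
... | yes _ = dist xs ys
... | no  _ = suc (dist xs ys)

Adj : (n : ℕ) → Subset n → Subset n → Set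
Adj n F G = IsFilter n F × IsFilter n G × dist F G ≡ 1

QAdj : (k : ℕ) → Vec Bool k → Vec Bool k → Set
QAdj k u v = dist u v ≡ 1

VSet : ℕ → Set
VSet n = Subset n → Bool

_⊆V_ : {n : ℕ} → VSet n → VSet n → Set
S ⊆V T = ∀ x → S x ≡ true → T x ≡ true

_≗V_ : {n : ℕ} → VSet n → VSet n → Set
S ≗V T = ∀ x → S x ≡ T x

IsCube : (n k : ℕ) → VSet n → Set
IsCube n k S =
  Σ (Vec Bool k → Subset n) λ f →
      (∀ u → IsFilter n (f u))
    × (∀ u v → f u ≡ f v → u ≡ v)
    × (∀ x → (S x ≡ true) ⇔ (∃ λ u → f u ≡ x))
    × (∀ u v → Adj n (f u) (f v) ⇔ QAdj k u v)

IsMaxCube : (n k : ℕ) → VSet n → Set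
IsMaxCube n k S = IsCube n k S × (∀ m T → k < m → IsCube n m T → ¬ (S ⊆V T))

-- h n k ≋ m :  h_{n,k} = m, i.e. the maximal k-cubes of Φ_n (vertex sets up to
-- extensional equality) are enumerated without repetition by Fin m.
_,_≋h_ : ℕ → ℕ → ℕ → Set
n , k ≋h m =
  Σ (Fin m → VSet n) λ c →
      (∀ i → IsMaxCube n k (c i))
    × (∀ i j → c i ≗V c j → i ≡ j)
    × (∀ S → IsMaxCube n k S → ∃ λ i → S ≗V c i)

module Submission where

-- The vertices of Φ_n form a set of vertices of the hypercube Q_n (filters as characteristic vectors), with the
-- induced adjacency. An induced hypercube of Q_n is a face {x | b ⊕ x ⊆ D}, so the cubes of Φ_n are the faces
-- made of filters, and such a cube is maximal iff its face cannot be widened by one more direction.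
--
-- For n ≥ 6 the last elements p = x_{n-2}, q = x_{n-1}, r = x_n of φ_n form a pendant path: q is comparable
-- only with p and r, below both for even n and above both for odd n, and p is extremal in φ_{n-2}. Let τ be
-- the value of q that forces p = r = τ. A filter of φ_n is then either a filter of φ_{n-2} with q ≠ τ and r
-- arbitrary, or a filter of φ_{n-3} with p = q = r = τ. A face fixing both q and r is never maximal, so a
-- maximal cube either frees r with q ≠ τ (a maximal cube of Φ_{n-2} times an edge) or frees q with p = r = τ
-- (a maximal cube of Φ_{n-3} times an edge), and this is a bijection. Hence h_{n,0} = 0 and
-- h_{n,k+1} = h_{n-2,k} + h_{n-3,k}, i.e. H_n = x H_{n-2} + x H_{n-3}.

open import Defs
open import Data.Bool using (Bool; true; false; not; _∧_; _∨_; _xor_; _≟_)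
open import Data.Bool.Properties
  using (xor-same; xor-comm; xor-assoc; xor-identityʳ; ∨-identityʳ; ∧-conicalˡ; ∧-conicalʳ;
         not-¬; ¬-not; not-involutive)
open import Data.Empty using (⊥-elim)
open import Data.Fin using (Fin; toℕ; fromℕ; inject₁; splitAt; join) renaming (zero to fzero; suc to fsuc)
open import Data.Fin.Properties
  using (toℕ-inject₁; toℕ-fromℕ; toℕ-injective; toℕ<n; splitAt-join; join-splitAt)
open import Data.Nat using (ℕ; zero; suc; pred; _+_; _*_; _∸_; _≤_; _<_; z≤n; s≤s)
open import Data.Nat.Properties
  using (≤-refl; ≤-pred; ≤-trans; n≤1+n; suc-injective; *-suc; <-asym; <-irrefl; <-≤-trans; <⇒≢;
         n<1+n; m∸n≤m)
open import Data.Product using (Σ; ∃; _×_; _,_; proj₁; proj₂)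
open import Data.Product.Function.NonDependent.Propositional using (_×-⇔_)
open import Data.Sum using (_⊎_; inj₁; inj₂)
open import Data.Vec using (Vec; []; _∷_; _∷ʳ_; replicate; zipWith; lookup; init; last; initLast)
open import Data.Vec.Properties
  using (∷-injectiveʳ; zipWith-comm; zipWith-assoc; zipWith-identityˡ; zipWith-identityʳ;
         init-∷ʳ; last-∷ʳ; []=⇒lookup; lookup⇒[]=)
open import Function using (id; _∘_)
open import Function.Bundles using (_⇔_; mk⇔; Equivalence)
open Equivalence using (to; from)
open import Function.Construct.Composition using (_⇔-∘_)
open import Function.Construct.Identity using (⇔-id)
open import Function.Construct.Symmetry using (⇔-sym)
open import Relation.Nullary using (¬_; yes; no)
open import Relation.Binary.PropositionalEquality
  using (_≡_; _≢_; refl; sym; trans; cong; cong₂; subst; subst₂; module ≡-Reasoning)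
open import Relation.Binary.Construct.Closure.ReflexiveTransitive using (Star; ε; _◅_; _◅◅_; gmap; fold)

variable
  k m n : ℕ

≡true⇔⇒≡ : {a b : Bool} → a ≡ true ⇔ b ≡ true → a ≡ b
≡true⇔⇒≡ {false} {false} _ = refl
≡true⇔⇒≡ {false} {true}  p = from p refl
≡true⇔⇒≡ {true}  {false} p = sym (to p refl)
≡true⇔⇒≡ {true}  {true}  _ = refl

_==_ : Bool → Bool → Bool
true  == b = b
false == b = not b

==⇔≡ : (a b : Bool) → a == b ≡ true ⇔ a ≡ b
==⇔≡ true  true  = mk⇔ (λ _ → refl) (λ _ → refl)
==⇔≡ true  false = mk⇔ (λ ()) (λ ())
==⇔≡ false true  = mk⇔ (λ ()) (λ ())
==⇔≡ false false = mk⇔ (λ _ → refl) (λ _ → refl)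

∧⇔× : (a b : Bool) → a ∧ b ≡ true ⇔ (a ≡ true × b ≡ true)
∧⇔× a b = mk⇔ (λ p → ∧-conicalˡ a b p , ∧-conicalʳ a b p) λ { (refl , refl) → refl }

contraposeᵇ : ∀ {a b c : Bool} → (a ≡ c → b ≡ c) → b ≡ not c → a ≡ not c
contraposeᵇ {a} {c = c} a→b b≡¬c with a ≟ c
... | yes a≡c = ⊥-elim (not-¬ (a→b a≡c) b≡¬c)
... | no  a≢c = ¬-not a≢c

contrapose-⇔ : ∀ {a b c : Bool} → (a ≡ c → b ≡ c) ⇔ (b ≡ not c → a ≡ not c)
contrapose-⇔ {a} {b} {c} = mk⇔ contraposeᵇ
  (λ h → subst (λ t → a ≡ t → b ≡ t) (not-involutive c) (contraposeᵇ h))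

-- Boolean vectors as vertices and as subsets of the hypercube

infixl 6 _⊕_
infixl 6 _∪_
infix 4 _⊆_ _~_ _∈ᵛ_

_⊕_ : Vec Bool n → Vec Bool n → Vec Bool n
_⊕_ = zipWith _xor_

_∪_ : Vec Bool n → Vec Bool n → Vec Bool n
_∪_ = zipWith _∨_

∅ : Vec Bool n
∅ = replicate _ false

weight : Vec Bool n → ℕ
weight []          = 0
weight (true ∷ x)  = suc (weight x)
weight (false ∷ x) = weight x

_⊆ᵇ_ : Vec Bool n → Vec Bool n → Bool
[]          ⊆ᵇ []          = true
(_ ∷ x)     ⊆ᵇ (true ∷ y)  = x ⊆ᵇ y
(false ∷ x) ⊆ᵇ (false ∷ y) = x ⊆ᵇ y
(true ∷ x)  ⊆ᵇ (false ∷ y) = false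

_⊆_ : Vec Bool n → Vec Bool n → Set
x ⊆ y = x ⊆ᵇ y ≡ true

_~_ : Vec Bool n → Vec Bool n → Set
x ~ y = weight (x ⊕ y) ≡ 1

_∈ᵛ_ : Vec Bool n → VSet n → Set
x ∈ᵛ S = S x ≡ true

face : Vec Bool n → Vec Bool n → VSet n
face b D x = (b ⊕ x) ⊆ᵇ D

⊕-comm : (x y : Vec Bool n) → x ⊕ y ≡ y ⊕ x
⊕-comm = zipWith-comm xor-comm

⊕-assoc : (x y z : Vec Bool n) → (x ⊕ y) ⊕ z ≡ x ⊕ (y ⊕ z)
⊕-assoc = zipWith-assoc xor-assoc

⊕-identityˡ : (x : Vec Bool n) → ∅ ⊕ x ≡ x
⊕-identityˡ = zipWith-identityˡ (λ _ → refl)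

⊕-identityʳ : (x : Vec Bool n) → x ⊕ ∅ ≡ x
⊕-identityʳ = zipWith-identityʳ xor-identityʳ

⊕-self : (x : Vec Bool n) → x ⊕ x ≡ ∅
⊕-self []      = refl
⊕-self (a ∷ x) = cong₂ _∷_ (xor-same a) (⊕-self x)

⊕-cancelˡ : (x y : Vec Bool n) → x ⊕ (x ⊕ y) ≡ y
⊕-cancelˡ x y = begin
  x ⊕ (x ⊕ y)  ≡⟨ ⊕-assoc x x y ⟨
  (x ⊕ x) ⊕ y  ≡⟨ cong (_⊕ y) (⊕-self x) ⟩
  ∅ ⊕ y        ≡⟨ ⊕-identityˡ y ⟩
  y            ∎
  where open ≡-Reasoning

⊕-cancelʳ : (x y : Vec Bool n) → (x ⊕ y) ⊕ y ≡ x
⊕-cancelʳ x y = trans (⊕-assoc x y y) (trans (cong (x ⊕_) (⊕-self y)) (⊕-identityʳ x))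

⊕≡⇒≡⊕ : (x y z : Vec Bool n) → x ⊕ y ≡ z → y ≡ x ⊕ z
⊕≡⇒≡⊕ x y z p = trans (sym (⊕-cancelˡ x y)) (cong (x ⊕_) p)

⊕-interchange : (a b c d : Vec Bool n) → (a ⊕ b) ⊕ (c ⊕ d) ≡ (a ⊕ c) ⊕ (b ⊕ d)
⊕-interchange a b c d = begin
  (a ⊕ b) ⊕ (c ⊕ d)  ≡⟨ ⊕-assoc a b (c ⊕ d) ⟩
  a ⊕ (b ⊕ (c ⊕ d))  ≡⟨ cong (a ⊕_) (⊕-assoc b c d) ⟨
  a ⊕ ((b ⊕ c) ⊕ d)  ≡⟨ cong (λ t → a ⊕ (t ⊕ d)) (⊕-comm b c) ⟩
  a ⊕ ((c ⊕ b) ⊕ d)  ≡⟨ cong (a ⊕_) (⊕-assoc c b d) ⟩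
  a ⊕ (c ⊕ (b ⊕ d))  ≡⟨ ⊕-assoc a c (b ⊕ d) ⟨
  (a ⊕ c) ⊕ (b ⊕ d)  ∎
  where open ≡-Reasoning

weight-∅ : weight (∅ {n}) ≡ 0
weight-∅ {zero}  = refl
weight-∅ {suc n} = weight-∅ {n}

weight≡0⇒≡∅ : (x : Vec Bool n) → weight x ≡ 0 → x ≡ ∅
weight≡0⇒≡∅ []          _ = refl
weight≡0⇒≡∅ (false ∷ x) p = cong (false ∷_) (weight≡0⇒≡∅ x p)

weight-⊕≡0⇒≡ : (x y : Vec Bool n) → weight (x ⊕ y) ≡ 0 → x ≡ y
weight-⊕≡0⇒≡ x y p = sym (trans (⊕≡⇒≡⊕ x y ∅ (weight≡0⇒≡∅ (x ⊕ y) p)) (⊕-identityʳ x))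

weight-∷-cong : (a : Bool) {x : Vec Bool m} {y : Vec Bool n} →
  weight x ≡ weight y → weight (a ∷ x) ≡ weight (a ∷ y)
weight-∷-cong true  p = cong suc p
weight-∷-cong false p = p

dist≡weight-⊕ : (x y : Vec Bool n) → dist x y ≡ weight (x ⊕ y)
dist≡weight-⊕ []          []          = refl
dist≡weight-⊕ (false ∷ x) (false ∷ y) = dist≡weight-⊕ x y
dist≡weight-⊕ (false ∷ x) (true ∷ y)  = cong suc (dist≡weight-⊕ x y)
dist≡weight-⊕ (true ∷ x)  (false ∷ y) = cong suc (dist≡weight-⊕ x y)
dist≡weight-⊕ (true ∷ x)  (true ∷ y)  = dist≡weight-⊕ x y

~-sym : {x y : Vec Bool n} → x ~ y → y ~ x
~-sym {x = x} {y} p = trans (cong weight (⊕-comm y x)) p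

⊆-refl : (x : Vec Bool n) → x ⊆ x
⊆-refl []          = refl
⊆-refl (false ∷ x) = ⊆-refl x
⊆-refl (true ∷ x)  = ⊆-refl x

∅⊆ : (D : Vec Bool n) → ∅ ⊆ D
∅⊆ []          = refl
∅⊆ (true ∷ D)  = ∅⊆ D
∅⊆ (false ∷ D) = ∅⊆ D

⊆∅⇒≡∅ : (x : Vec Bool n) → x ⊆ ∅ → x ≡ ∅
⊆∅⇒≡∅ []          _ = refl
⊆∅⇒≡∅ (false ∷ x) p = cong (false ∷_) (⊆∅⇒≡∅ x p)

⊆-trans : (x y z : Vec Bool n) → x ⊆ y → y ⊆ z → x ⊆ z
⊆-trans []          []          []          _ _ = refl
⊆-trans (_ ∷ x)     (true ∷ y)  (true ∷ z)  p q = ⊆-trans x y z p q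
⊆-trans (false ∷ x) (false ∷ y) (true ∷ z)  p q = ⊆-trans x y z p q
⊆-trans (false ∷ x) (false ∷ y) (false ∷ z) p q = ⊆-trans x y z p q

⊆-∪ˡ : (x D E : Vec Bool n) → x ⊆ D → x ⊆ D ∪ E
⊆-∪ˡ []          []          []          _ = refl
⊆-∪ˡ (_ ∷ x)     (true ∷ D)  (_ ∷ E)     p = ⊆-∪ˡ x D E p
⊆-∪ˡ (false ∷ x) (false ∷ D) (true ∷ E)  p = ⊆-∪ˡ x D E p
⊆-∪ˡ (false ∷ x) (false ∷ D) (false ∷ E) p = ⊆-∪ˡ x D E p

⊆-∪ʳ : (x D E : Vec Bool n) → x ⊆ E → x ⊆ D ∪ E
⊆-∪ʳ []          []          []          _ = refl
⊆-∪ʳ (_ ∷ x)     (true ∷ D)  (true ∷ E)  p = ⊆-∪ʳ x D E p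
⊆-∪ʳ (_ ∷ x)     (false ∷ D) (true ∷ E)  p = ⊆-∪ʳ x D E p
⊆-∪ʳ (false ∷ x) (true ∷ D)  (false ∷ E) p = ⊆-∪ʳ x D E p
⊆-∪ʳ (false ∷ x) (false ∷ D) (false ∷ E) p = ⊆-∪ʳ x D E p

⊆-⊕ : (x y D : Vec Bool n) → x ⊆ D → y ⊆ D → x ⊕ y ⊆ D
⊆-⊕ []          []          []          _ _ = refl
⊆-⊕ (_ ∷ x)     (_ ∷ y)     (true ∷ D)  p q = ⊆-⊕ x y D p q
⊆-⊕ (false ∷ x) (false ∷ y) (false ∷ D) p q = ⊆-⊕ x y D p q

∪-∅ : (D : Vec Bool n) → D ∪ ∅ ≡ D
∪-∅ = zipWith-identityʳ ∨-identityʳ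

data IsUnit : Vec Bool n → Set where
  here  : IsUnit (true ∷ ∅ {n})
  there : {e : Vec Bool n} → IsUnit e → IsUnit (false ∷ e)

weight≡1⇒IsUnit : (x : Vec Bool n) → weight x ≡ 1 → IsUnit x
weight≡1⇒IsUnit (false ∷ x) p = there (weight≡1⇒IsUnit x p)
weight≡1⇒IsUnit (true ∷ x)  p with weight≡0⇒≡∅ x (cong pred p)
... | refl = here

⊆-∪-unit : {e : Vec Bool n} (y D : Vec Bool n) → IsUnit e → ¬ e ⊆ D →
  y ⊆ D ∪ e → y ⊆ D ⊎ y ⊕ e ⊆ D
⊆-∪-unit (_ ∷ y)     (true ∷ D)  here      e⊈D _ = ⊥-elim (e⊈D (∅⊆ D))
⊆-∪-unit (false ∷ y) (false ∷ D) here      _   p = inj₁ (subst (y ⊆_) (∪-∅ D) p)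
⊆-∪-unit (true ∷ y)  (false ∷ D) here      _   p =
  inj₂ (subst (_⊆ D) (sym (⊕-identityʳ y)) (subst (y ⊆_) (∪-∅ D) p))
⊆-∪-unit (_ ∷ y)     (true ∷ D)  (there u) e⊈D p = ⊆-∪-unit y D u e⊈D p
⊆-∪-unit (false ∷ y) (false ∷ D) (there u) e⊈D p = ⊆-∪-unit y D u e⊈D p

weight-∪-unit : {e : Vec Bool n} (D : Vec Bool n) → IsUnit e → ¬ e ⊆ D →
  weight (D ∪ e) ≡ suc (weight D)
weight-∪-unit (true ∷ D)  here      e⊈D = ⊥-elim (e⊈D (∅⊆ D))
weight-∪-unit (false ∷ D) here      _   = cong (suc ∘ weight) (∪-∅ D)
weight-∪-unit (true ∷ D)  (there u) e⊈D = cong suc (weight-∪-unit D u e⊈D)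
weight-∪-unit (false ∷ D) (there u) e⊈D = weight-∪-unit D u e⊈D

unit-sum-unit⇒≡ : {x y z : Vec Bool n} → IsUnit x → IsUnit y → IsUnit z →
  weight (x ⊕ (y ⊕ z)) ≡ 1 → x ≢ y → x ≢ z → y ≡ z
unit-sum-unit⇒≡ here here _ _ x≢y _ = ⊥-elim (x≢y refl)
unit-sum-unit⇒≡ here (there _) here _ _ x≢z = ⊥-elim (x≢z refl)
unit-sum-unit⇒≡ here (there {e = y} _) (there {e = z} _) p _ _ =
  cong (false ∷_) (weight-⊕≡0⇒≡ y z (subst (λ t → weight t ≡ 0) (⊕-identityˡ (y ⊕ z)) (cong pred p)))
unit-sum-unit⇒≡ (there _) here here _ _ _ = refl
unit-sum-unit⇒≡ (there {e = x} _) here (there {e = z} _) p _ x≢z =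
  ⊥-elim (x≢z (cong (false ∷_)
    (weight-⊕≡0⇒≡ x z (subst (λ t → weight (x ⊕ t) ≡ 0) (⊕-identityˡ z) (cong pred p)))))
unit-sum-unit⇒≡ (there {e = x} _) (there {e = y} _) here p x≢y _ =
  ⊥-elim (x≢y (cong (false ∷_)
    (weight-⊕≡0⇒≡ x y (subst (λ t → weight (x ⊕ t) ≡ 0) (⊕-identityʳ y) (cong pred p)))))
unit-sum-unit⇒≡ (there ux) (there uy) (there uz) p x≢y x≢z =
  cong (false ∷_) (unit-sum-unit⇒≡ ux uy uz p (x≢y ∘ cong (false ∷_)) (x≢z ∘ cong (false ∷_)))

square-parallel : {a b c d : Vec Bool n} → a ~ b → b ~ c → c ~ d → a ~ d → a ≢ c → b ≢ d →
  a ⊕ d ≡ b ⊕ c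
square-parallel {n} {a} {b} {c} {d} ab bc cd ad a≢c b≢d =
  unit-sum-unit⇒≡ (weight≡1⇒IsUnit _ ab) (weight≡1⇒IsUnit _ ad) (weight≡1⇒IsUnit _ bc)
    (subst (λ (t : Vec Bool n) → weight t ≡ 1) (sym sum≡) (~-sym {x = c} cd))
    (λ e → b≢d (trans (sym (⊕-cancelˡ a b)) (trans (cong (a ⊕_) e) (⊕-cancelˡ a d))))
    (λ e → a≢c (trans (sym (⊕-cancelʳ a b))
                 (trans (cong (_⊕ b) (trans e (⊕-comm b c))) (⊕-cancelʳ c b))))
  where
  open ≡-Reasoning
  sum≡ : (a ⊕ b) ⊕ ((a ⊕ d) ⊕ (b ⊕ c)) ≡ d ⊕ c
  sum≡ = begin
    (a ⊕ b) ⊕ ((a ⊕ d) ⊕ (b ⊕ c))  ≡⟨ cong ((a ⊕ b) ⊕_) (⊕-interchange a d b c) ⟩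
    (a ⊕ b) ⊕ ((a ⊕ b) ⊕ (d ⊕ c))  ≡⟨ ⊕-cancelˡ (a ⊕ b) (d ⊕ c) ⟩
    d ⊕ c                          ∎

false∷~true∷ : (u : Vec Bool n) → false ∷ u ~ true ∷ u
false∷~true∷ {n} u = cong suc (trans (cong weight (⊕-self u)) (weight-∅ {n}))

walk-from-∅ : (u : Vec Bool n) → Star _~_ ∅ u
walk-from-∅ []          = ε
walk-from-∅ (false ∷ u) = gmap (false ∷_) id (walk-from-∅ u)
walk-from-∅ (true ∷ u)  = gmap (false ∷_) id (walk-from-∅ u) ◅◅ (false∷~true∷ u ◅ ε)

locally-constant⇒constant : {A : Set} (g : Vec Bool n → A) →
  (∀ {u v} → u ~ v → g u ≡ g v) → ∀ u → g u ≡ g ∅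
locally-constant⇒constant g loc u =
  sym (fold (λ a b → g a ≡ g b) (λ uv p → trans (loc uv) p) refl (walk-from-∅ u))

∀∷ʳ : {A : Set} {P : Vec A (suc n) → Set} → (∀ xs x → P (xs ∷ʳ x)) → ∀ v → P v
∀∷ʳ h v with initLast v
... | xs , x , refl = h xs x

∀∷ʳ² : {A : Set} {P : Vec A (suc (suc n)) → Set} →
  (∀ xs x y → P (xs ∷ʳ x ∷ʳ y)) → ∀ v → P v
∀∷ʳ² {P = P} h = ∀∷ʳ λ xs y → ∀∷ʳ {P = λ xs → P (xs ∷ʳ y)} (λ ys x → h ys x y) xs

∀∷ʳ³ : {A : Set} {P : Vec A (suc (suc (suc n))) → Set} →
  (∀ xs x y z → P (xs ∷ʳ x ∷ʳ y ∷ʳ z)) → ∀ v → P v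
∀∷ʳ³ {P = P} h = ∀∷ʳ² λ xs y z → ∀∷ʳ {P = λ xs → P (xs ∷ʳ y ∷ʳ z)} (λ ys x → h ys x y z) xs

⊕-∷ʳ : (x y : Vec Bool n) (a c : Bool) → (x ∷ʳ a) ⊕ (y ∷ʳ c) ≡ (x ⊕ y) ∷ʳ (a xor c)
⊕-∷ʳ []      []      a c = refl
⊕-∷ʳ (b ∷ x) (d ∷ y) a c = cong ((b xor d) ∷_) (⊕-∷ʳ x y a c)

⊆-∷ʳ : (x D : Vec Bool n) (a d : Bool) →
  (x ∷ʳ a) ⊆ (D ∷ʳ d) ⇔ (x ⊆ D × (a ≡ true → d ≡ true))
⊆-∷ʳ []          []          a     true  = mk⇔ (λ _ → refl , λ _ → refl) (λ _ → refl)
⊆-∷ʳ []          []          false false = mk⇔ (λ _ → refl , λ ()) (λ _ → refl)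
⊆-∷ʳ []          []          true  false = mk⇔ (λ ()) (λ { (_ , p) → p refl })
⊆-∷ʳ (_ ∷ x)     (true ∷ D)  a     d     = ⊆-∷ʳ x D a d
⊆-∷ʳ (false ∷ x) (false ∷ D) a     d     = ⊆-∷ʳ x D a d
⊆-∷ʳ (true ∷ x)  (false ∷ D) a     d     = mk⇔ (λ ()) (λ { (() , _) })

weight-∷ʳ : (x : Vec Bool n) (a : Bool) → weight (x ∷ʳ a) ≡ weight (a ∷ x)
weight-∷ʳ []          _     = refl
weight-∷ʳ (true ∷ x)  true  = cong suc (weight-∷ʳ x true)
weight-∷ʳ (true ∷ x)  false = cong suc (weight-∷ʳ x false)
weight-∷ʳ (false ∷ x) true  = weight-∷ʳ x true
weight-∷ʳ (false ∷ x) false = weight-∷ʳ x false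

weight-∷ʳ² : (x : Vec Bool n) (a c : Bool) → weight (x ∷ʳ a ∷ʳ c) ≡ weight (c ∷ a ∷ x)
weight-∷ʳ² x a c = trans (weight-∷ʳ (x ∷ʳ a) c) (weight-∷-cong c (weight-∷ʳ x a))

base∈face : (b D : Vec Bool n) → b ∈ᵛ face b D
base∈face b D = subst (_⊆ D) (sym (⊕-self b)) (∅⊆ D)

face-mono : (b : Vec Bool n) {D D′ : Vec Bool n} → D ⊆ D′ → face b D ⊆V face b D′
face-mono b {D} {D′} D⊆D′ x p = ⊆-trans (b ⊕ x) D D′ p D⊆D′

face-rebase : (b b′ D : Vec Bool n) → b ∈ᵛ face b′ D → face b′ D ⊆V face b D
face-rebase b b′ D b∈ x p =
  subst (_⊆ D) eq (⊆-⊕ (b ⊕ b′) (b′ ⊕ x) D (subst (_⊆ D) (⊕-comm b′ b) b∈) p)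
  where
  eq : (b ⊕ b′) ⊕ (b′ ⊕ x) ≡ b ⊕ x
  eq = trans (⊕-assoc b b′ (b′ ⊕ x)) (cong (b ⊕_) (⊕-cancelˡ b′ x))

face-⊆⇒dirs-⊆ : (b D D′ : Vec Bool n) → face b D ⊆V face b D′ → D ⊆ D′
face-⊆⇒dirs-⊆ b D D′ sub =
  subst (_⊆ D′) (⊕-cancelˡ b D) (sub (b ⊕ D) (subst (_⊆ D) (sym (⊕-cancelˡ b D)) (⊆-refl D)))

one-more-direction : (D D′ : Vec Bool n) → D ⊆ D′ → weight D < weight D′ →
  Σ (Vec Bool n) λ D₂ → D ⊆ D₂ × weight D₂ ≡ suc (weight D) × D₂ ⊆ D′
one-more-direction (false ∷ D) (true ∷ D′) D⊆D′ _ = true ∷ D , ⊆-refl D , refl , D⊆D′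
one-more-direction (false ∷ D) (false ∷ D′) D⊆D′ lt =
  let D₂ , D⊆D₂ , weight-D₂ , D₂⊆D′ = one-more-direction D D′ D⊆D′ lt in
  false ∷ D₂ , D⊆D₂ , weight-D₂ , D₂⊆D′
one-more-direction (true ∷ D) (true ∷ D′) D⊆D′ (s≤s lt) =
  let D₂ , D⊆D₂ , weight-D₂ , D₂⊆D′ = one-more-direction D D′ D⊆D′ lt in
  true ∷ D₂ , D⊆D₂ , cong suc weight-D₂ , D₂⊆D′

∈face-∷ʳ : (b D x : Vec Bool n) (c d a : Bool) →
  (x ∷ʳ a) ∈ᵛ face (b ∷ʳ c) (D ∷ʳ d) ⇔ (x ∈ᵛ face b D × (c xor a ≡ true → d ≡ true))
∈face-∷ʳ b D x c d a = subst (λ t → (t ⊆ D ∷ʳ d) ⇔ (x ∈ᵛ face b D × (c xor a ≡ true → d ≡ true)))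
  (sym (⊕-∷ʳ b x c a)) (⊆-∷ʳ (b ⊕ x) D (c xor a) d)

∈face-∷ʳ-free : (b D x : Vec Bool n) (c a : Bool) →
  (x ∷ʳ a) ∈ᵛ face (b ∷ʳ c) (D ∷ʳ true) ⇔ x ∈ᵛ face b D
∈face-∷ʳ-free b D x c a = mk⇔ (proj₁ ∘ to (∈face-∷ʳ b D x c true a))
  (λ p → from (∈face-∷ʳ b D x c true a) (p , λ _ → refl))

∈face-∷ʳ-fixed : (b D x : Vec Bool n) (c a : Bool) →
  (x ∷ʳ a) ∈ᵛ face (b ∷ʳ c) (D ∷ʳ false) ⇔ (x ∈ᵛ face b D × a ≡ c)
∈face-∷ʳ-fixed b D x c a = mk⇔
  (λ p → let x∈ , fixed = to (∈face-∷ʳ b D x c false a) p in x∈ , fixed⇒≡ c a fixed)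
  (λ (x∈ , a≡c) → from (∈face-∷ʳ b D x c false a) (x∈ , ≡⇒fixed a≡c))
  where
  fixed⇒≡ : ∀ c a → (c xor a ≡ true → false ≡ true) → a ≡ c
  fixed⇒≡ false false _ = refl
  fixed⇒≡ true  true  _ = refl
  fixed⇒≡ false true  p = sym (p refl)
  fixed⇒≡ true  false p = p refl

  ≡⇒fixed : ∀ {c a} → a ≡ c → c xor a ≡ true → false ≡ true
  ≡⇒fixed {c} refl p = trans (sym (xor-same c)) p

∈face-∷ʳ-base : (b D x : Vec Bool n) (c d : Bool) → x ∈ᵛ face b D →
  (x ∷ʳ c) ∈ᵛ face (b ∷ʳ c) (D ∷ʳ d)
∈face-∷ʳ-base b D x c d p =
  from (∈face-∷ʳ b D x c d c) (p , λ e → ⊥-elim (not-¬ (trans (sym e) (xor-same c)) refl))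

face-map : (b D : Vec Bool n) → Vec Bool (weight D) → Vec Bool n
face-map []      []          []      = []
face-map (_ ∷ b) (true ∷ D)  (a ∷ u) = a ∷ face-map b D u
face-map (c ∷ b) (false ∷ D) u       = c ∷ face-map b D u

face-coords : (D x : Vec Bool n) → Vec Bool (weight D)
face-coords []          []      = []
face-coords (true ∷ D)  (a ∷ x) = a ∷ face-coords D x
face-coords (false ∷ D) (_ ∷ x) = face-coords D x

face-map-∈ : (b D : Vec Bool n) (u : Vec Bool (weight D)) → face-map b D u ∈ᵛ face b D
face-map-∈ []          []          []      = refl
face-map-∈ (_ ∷ b)     (true ∷ D)  (_ ∷ u) = face-map-∈ b D u
face-map-∈ (false ∷ b) (false ∷ D) u       = face-map-∈ b D u
face-map-∈ (true ∷ b)  (false ∷ D) u       = face-map-∈ b D u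

face-map-coords : (b D x : Vec Bool n) → x ∈ᵛ face b D → face-map b D (face-coords D x) ≡ x
face-map-coords []          []          []          _ = refl
face-map-coords (_ ∷ b)     (true ∷ D)  (a ∷ x)     p = cong (a ∷_) (face-map-coords b D x p)
face-map-coords (false ∷ b) (false ∷ D) (false ∷ x) p = cong (false ∷_) (face-map-coords b D x p)
face-map-coords (true ∷ b)  (false ∷ D) (true ∷ x)  p = cong (true ∷_) (face-map-coords b D x p)

face-map-weight : (b D : Vec Bool n) (u v : Vec Bool (weight D)) →
  weight (face-map b D u ⊕ face-map b D v) ≡ weight (u ⊕ v)
face-map-weight []      []          []      []      = refl
face-map-weight (_ ∷ b) (true ∷ D)  (a ∷ u) (a′ ∷ v) =
  weight-∷-cong (a xor a′) (face-map-weight b D u v)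
face-map-weight (c ∷ b) (false ∷ D) u       v       =
  trans (cong (λ t → weight (t ∷ (face-map b D u ⊕ face-map b D v))) (xor-same c))
    (face-map-weight b D u v)

face-map-dist : (b D : Vec Bool n) (u v : Vec Bool (weight D)) →
  dist (face-map b D u) (face-map b D v) ≡ dist u v
face-map-dist b D u v = begin
  dist (face-map b D u) (face-map b D v)    ≡⟨ dist≡weight-⊕ (face-map b D u) (face-map b D v) ⟩
  weight (face-map b D u ⊕ face-map b D v)  ≡⟨ face-map-weight b D u v ⟩
  weight (u ⊕ v)                            ≡⟨ dist≡weight-⊕ u v ⟨
  dist u v                                  ∎
  where open ≡-Reasoning

face-map-injective : (b D : Vec Bool n) (u v : Vec Bool (weight D)) →
  face-map b D u ≡ face-map b D v → u ≡ v
face-map-injective {n} b D u v p = weight-⊕≡0⇒≡ u v (begin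
  weight (u ⊕ v)                            ≡⟨ face-map-weight b D u v ⟨
  weight (face-map b D u ⊕ face-map b D v)  ≡⟨ cong (λ t → weight (t ⊕ face-map b D v)) p ⟩
  weight (face-map b D v ⊕ face-map b D v)  ≡⟨ cong weight (⊕-self (face-map b D v)) ⟩
  weight (∅ {n})                            ≡⟨ weight-∅ {n} ⟩
  0                                         ∎)
  where open ≡-Reasoning

-- Induced hypercubes of the hypercube are faces

ImageIsFace : (Vec Bool k → Vec Bool n) → Set
ImageIsFace {k} {n} f = Σ (Vec Bool n) λ b → Σ (Vec Bool n) λ D →
  weight D ≡ k × (∀ u → f u ∈ᵛ face b D) × (∀ x → x ∈ᵛ face b D → ∃ λ u → f u ≡ x)

module Rungs (f : Vec Bool (suc k) → Vec Bool n) (inj : ∀ u v → f u ≡ f v → u ≡ v)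
             (adj : ∀ {u v} → u ~ v → f u ~ f v) where

  f₀ f₁ : Vec Bool k → Vec Bool n
  f₀ u = f (false ∷ u)
  f₁ u = f (true ∷ u)

  f₀≢f₁ : ∀ {u v} → f₀ u ≢ f₁ v
  f₀≢f₁ p with inj _ _ p
  ... | ()

  rung : Vec Bool n
  rung = f₀ ∅ ⊕ f₁ ∅

  rung-unit : IsUnit rung
  rung-unit = weight≡1⇒IsUnit rung (adj (false∷~true∷ (∅ {k})))

  -- Consecutive rungs f₀ u — f₁ u and f₀ v — f₁ v bound a square, so all rungs are parallel.
  rung-direction : ∀ u → f₀ u ⊕ f₁ u ≡ rung
  rung-direction = locally-constant⇒constant (λ u → f₀ u ⊕ f₁ u) λ {u} {v} uv →
    square-parallel (adj uv) (adj (false∷~true∷ v)) (adj (~-sym {x = u} uv)) (adj (false∷~true∷ u))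
      f₀≢f₁ f₀≢f₁

  f₁≡f₀⊕rung : ∀ u → f₁ u ≡ f₀ u ⊕ rung
  f₁≡f₀⊕rung u = ⊕≡⇒≡⊕ (f₀ u) (f₁ u) rung (rung-direction u)

  extend-face : ImageIsFace f₀ → ImageIsFace f
  extend-face (b , D , weight-D , image⊆face₀ , face⊆image₀) =
    b , D ∪ rung , trans (weight-∪-unit D rung-unit rung⊈D) (cong suc weight-D) ,
    image⊆face , face⊆image
    where
    rung⊈D : ¬ rung ⊆ D
    rung⊈D rung⊆D with face⊆image₀ (f₀ ∅ ⊕ rung)
      (subst (_⊆ D) (⊕-assoc b (f₀ ∅) rung) (⊆-⊕ (b ⊕ f₀ ∅) rung D (image⊆face₀ ∅) rung⊆D))
    ... | u , p = f₀≢f₁ (trans p (sym (f₁≡f₀⊕rung ∅)))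

    image⊆face : ∀ u → f u ∈ᵛ face b (D ∪ rung)
    image⊆face (false ∷ u) = ⊆-∪ˡ (b ⊕ f₀ u) D rung (image⊆face₀ u)
    image⊆face (true ∷ u)  = subst (λ t → b ⊕ t ⊆ D ∪ rung) (sym (f₁≡f₀⊕rung u))
      (subst (_⊆ D ∪ rung) (⊕-assoc b (f₀ u) rung)
        (⊆-⊕ (b ⊕ f₀ u) rung (D ∪ rung)
          (⊆-∪ˡ (b ⊕ f₀ u) D rung (image⊆face₀ u)) (⊆-∪ʳ rung D rung (⊆-refl rung))))

    face⊆image : ∀ x → x ∈ᵛ face b (D ∪ rung) → ∃ λ u → f u ≡ x
    face⊆image x p with ⊆-∪-unit (b ⊕ x) D rung-unit rung⊈D p
    ... | inj₁ q = let u , r = face⊆image₀ x q in false ∷ u , r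
    ... | inj₂ q = let u , r = face⊆image₀ (x ⊕ rung) (subst (_⊆ D) (⊕-assoc b x rung) q) in
      true ∷ u , trans (f₁≡f₀⊕rung u) (trans (cong (_⊕ rung) r) (⊕-cancelʳ x rung))

induced-cube-is-face : (f : Vec Bool k → Vec Bool n) → (∀ u v → f u ≡ f v → u ≡ v) →
  (∀ {u v} → u ~ v → f u ~ f v) → ImageIsFace f
induced-cube-is-face {zero} {n} f _ _ = f [] , ∅ , weight-∅ {n} , image⊆face , face⊆image
  where
  image⊆face : ∀ u → f u ∈ᵛ face (f []) ∅
  image⊆face [] = subst (_⊆ ∅) (sym (⊕-self (f []))) (∅⊆ (∅ {n}))

  face⊆image : ∀ x → x ∈ᵛ face (f []) ∅ → ∃ λ u → f u ≡ x
  face⊆image x p = [] , sym (trans (⊕≡⇒≡⊕ (f []) x ∅ (⊆∅⇒≡∅ (f [] ⊕ x) p)) (⊕-identityʳ (f [])))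
induced-cube-is-face {suc k} f inj adj = Rungs.extend-face f inj adj
  (induced-cube-is-face (f ∘ (false ∷_)) (λ u v p → ∷-injectiveʳ (inj _ _ p)) adj)

-- Cubes of an induced subgraph of the hypercube

-- IsCube, IsMaxCube and _,_≋h_ with the filters of φ_n replaced by an arbitrary vertex set A of Q_n.
IsCubeOf : (Vec Bool n → Set) → ℕ → VSet n → Set
IsCubeOf {n} A k S =
  Σ (Vec Bool k → Vec Bool n) λ f →
      (∀ u → A (f u))
    × (∀ u v → f u ≡ f v → u ≡ v)
    × (∀ x → (S x ≡ true) ⇔ (∃ λ u → f u ≡ x))
    × (∀ u v → (A (f u) × A (f v) × dist (f u) (f v) ≡ 1) ⇔ QAdj k u v)

IsMaxCubeOf : (Vec Bool n → Set) → ℕ → VSet n → Set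
IsMaxCubeOf A k S = IsCubeOf A k S × (∀ m T → k < m → IsCubeOf A m T → ¬ (S ⊆V T))

MaxCubeCount : (Vec Bool n → Set) → ℕ → ℕ → Set
MaxCubeCount {n} A k c =
  Σ (Fin c → VSet n) λ cube →
      (∀ i → IsMaxCubeOf A k (cube i))
    × (∀ i j → cube i ≗V cube j → i ≡ j)
    × (∀ S → IsMaxCubeOf A k S → ∃ λ i → S ≗V cube i)

FaceIn : (Vec Bool n → Set) → Vec Bool n → Vec Bool n → Set
FaceIn A b D = ∀ x → x ∈ᵛ face b D → A x

MaxFaceIn : (Vec Bool n → Set) → Vec Bool n → Vec Bool n → Set
MaxFaceIn A b D =
  FaceIn A b D × (∀ D′ → D ⊆ D′ → weight D′ ≡ suc (weight D) → ¬ FaceIn A b D′)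

face-is-cube : {A : Vec Bool n → Set} (b D : Vec Bool n) → FaceIn A b D →
  IsCubeOf A (weight D) (face b D)
face-is-cube {A = A} b D inA =
  face-map b D , (λ u → inA _ (face-map-∈ b D u)) , face-map-injective b D , image , adjacency
  where
  image : ∀ x → (x ∈ᵛ face b D) ⇔ (∃ λ u → face-map b D u ≡ x)
  image x = mk⇔ (λ p → face-coords D x , face-map-coords b D x p) λ { (u , refl) → face-map-∈ b D u }

  adjacency : ∀ u v →
    (A (face-map b D u) × A (face-map b D v) × dist (face-map b D u) (face-map b D v) ≡ 1) ⇔ QAdj (weight D) u v
  adjacency u v = mk⇔ (λ (_ , _ , d) → trans (sym (face-map-dist b D u v)) d)
    (λ d → inA _ (face-map-∈ b D u) , inA _ (face-map-∈ b D v) , trans (face-map-dist b D u v) d)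

cube-is-face : {A : Vec Bool n → Set} {S : VSet n} → IsCubeOf A k S →
  Σ (Vec Bool n) λ b → Σ (Vec Bool n) λ D → weight D ≡ k × S ≗V face b D × FaceIn A b D
cube-is-face {A = A} {S} (f , inA , inj , image , adjacency)
  with induced-cube-is-face f inj (λ {u} {v} uv →
         trans (sym (dist≡weight-⊕ (f u) (f v)))
           (proj₂ (proj₂ (from (adjacency u v) (trans (dist≡weight-⊕ u v) uv)))))
... | b , D , weight-D , image⊆face , face⊆image = b , D , weight-D , S≗face , face-in-A
  where
  S≗face : S ≗V face b D
  S≗face x = ≡true⇔⇒≡ (mk⇔
    (λ p → let u , fu≡x = to (image x) p in subst (_∈ᵛ face b D) fu≡x (image⊆face u))
    (λ p → from (image x) (face⊆image x p)))

  face-in-A : FaceIn A b D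
  face-in-A x p = let u , fu≡x = face⊆image x p in subst A fu≡x (inA u)

cube-nonempty : {A : Vec Bool n → Set} {S : VSet n} → IsCubeOf A k S → ∃ λ x → x ∈ᵛ S
cube-nonempty (f , _ , _ , image , _) = f ∅ , from (image (f ∅)) (∅ , refl)

cube-resp : {A : Vec Bool n → Set} {S T : VSet n} → S ≗V T → IsCubeOf A k S → IsCubeOf A k T
cube-resp S≗T (f , inA , inj , image , adjacency) =
  f , inA , inj , (λ x → mk⇔ (λ p → to (image x) (trans (S≗T x) p))
                             (λ p → trans (sym (S≗T x)) (from (image x) p))) , adjacency

max-cube-resp : {A : Vec Bool n → Set} {S T : VSet n} → S ≗V T → IsMaxCubeOf A k S → IsMaxCubeOf A k T
max-cube-resp {A = A} S≗T (cube , maximal) = cube-resp {A = A} S≗T cube ,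
  λ m U k<m cubeU T⊆U → maximal m U k<m cubeU (λ x p → T⊆U x (trans (sym (S≗T x)) p))

max-cube-is-max-face : {A : Vec Bool n → Set} {S : VSet n} → IsMaxCubeOf A k S →
  Σ (Vec Bool n) λ b → Σ (Vec Bool n) λ D → weight D ≡ k × S ≗V face b D × MaxFaceIn A b D
max-cube-is-max-face {k = k} {A = A} {S = S} (cube , maximal) with cube-is-face cube
... | b , D , weight-D , S≗face , face-in-A = b , D , weight-D , S≗face , face-in-A , not-extendable
  where
  not-extendable : ∀ D′ → D ⊆ D′ → weight D′ ≡ suc (weight D) → ¬ FaceIn A b D′
  not-extendable D′ D⊆D′ weight-D′ face′-in-A =
    maximal (weight D′) (face b D′) (subst (k <_) (sym (trans weight-D′ (cong suc weight-D))) ≤-refl)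
      (face-is-cube b D′ face′-in-A) (λ x p → face-mono b D⊆D′ x (trans (sym (S≗face x)) p))

max-face-is-max-cube : {A : Vec Bool n → Set} (b D : Vec Bool n) → weight D ≡ k → MaxFaceIn A b D →
  IsMaxCubeOf A k (face b D)
max-face-is-max-cube {k = k} {A = A} b D weight-D (face-in-A , not-extendable) =
  subst (λ t → IsCubeOf A t (face b D)) weight-D (face-is-cube b D face-in-A) , maximal
  where
  maximal : ∀ m T → k < m → IsCubeOf A m T → ¬ (face b D ⊆V T)
  maximal m T k<m cubeT face⊆T with cube-is-face cubeT
  ... | b′ , D′ , weight-D′ , T≗face′ , face′-in-A =
    let D₂ , D⊆D₂ , weight-D₂ , D₂⊆D′ =
          one-more-direction D D′ D⊆D′ (subst₂ _<_ (sym weight-D) (sym weight-D′) k<m)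
    in not-extendable D₂ D⊆D₂ weight-D₂ λ x p →
         face′-in-A x (face-rebase b′ b D′ b′∈face x (face-mono b D₂⊆D′ x p))
    where
    b∈face′ : b ∈ᵛ face b′ D′
    b∈face′ = trans (sym (T≗face′ b)) (face⊆T b (base∈face b D))

    b′∈face : b′ ∈ᵛ face b D′
    b′∈face = subst (_⊆ D′) (⊕-comm b′ b) b∈face′

    D⊆D′ : D ⊆ D′
    D⊆D′ = face-⊆⇒dirs-⊆ b D D′ λ x p →
      face-rebase b b′ D′ b∈face′ x (trans (sym (T≗face′ x)) (face⊆T x p))

module PendantTail {m : ℕ} (τ : Bool)
  (A₀ : Vec Bool m → Set) (A₁ : Vec Bool (suc m) → Set) (A₃ : Vec Bool (3 + m) → Set)
  (A₃⇔ : ∀ xs q r → A₃ (xs ∷ʳ q ∷ʳ r) ⇔ (A₁ xs × (q ≡ τ → last xs ≡ τ) × (q ≡ τ → r ≡ τ)))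
  (A₁⇔ : ∀ ys → A₁ (ys ∷ʳ τ) ⇔ A₀ ys)
  where

  τ≢not-τ : τ ≢ not τ
  τ≢not-τ = not-¬ refl

  τ-or-not-τ : ∀ b → b ≡ τ ⊎ b ≡ not τ
  τ-or-not-τ b with b ≟ τ
  ... | yes b≡τ = inj₁ b≡τ
  ... | no  b≢τ = inj₂ (¬-not b≢τ)

  A₃⇒A₁ : ∀ {xs q r} → A₃ (xs ∷ʳ q ∷ʳ r) → A₁ xs
  A₃⇒A₁ a = proj₁ (to (A₃⇔ _ _ _) a)

  A₃⇒A₀ : ∀ {ys q r} → A₃ (ys ∷ʳ τ ∷ʳ q ∷ʳ r) → A₀ ys
  A₃⇒A₀ a = to (A₁⇔ _) (A₃⇒A₁ a)

  A₁⇒A₃ : ∀ {xs r} → A₁ xs → A₃ (xs ∷ʳ not τ ∷ʳ r)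
  A₁⇒A₃ a = from (A₃⇔ _ _ _) (a , (λ e → ⊥-elim (τ≢not-τ (sym e))) , (λ e → ⊥-elim (τ≢not-τ (sym e))))

  A₀⇒A₃ : ∀ {ys q} → A₀ ys → A₃ (ys ∷ʳ τ ∷ʳ q ∷ʳ τ)
  A₀⇒A₃ {ys} a = from (A₃⇔ _ _ _) (from (A₁⇔ ys) a , (λ _ → last-∷ʳ τ ys) , λ _ → refl)

  ¬A₃-q-active-r-inactive : ∀ {xs} → ¬ A₃ (xs ∷ʳ τ ∷ʳ not τ)
  ¬A₃-q-active-r-inactive a = τ≢not-τ (sym (proj₂ (proj₂ (to (A₃⇔ _ _ _) a)) refl))

  ¬A₃-p-inactive-q-active : ∀ {ys r} → ¬ A₃ (ys ∷ʳ not τ ∷ʳ τ ∷ʳ r)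
  ¬A₃-p-inactive-q-active {ys} a =
    τ≢not-τ (trans (sym (proj₁ (proj₂ (to (A₃⇔ _ _ _) a)) refl)) (last-∷ʳ (not τ) ys))

  lift₂ : VSet (suc m) → VSet (3 + m)
  lift₂ S G = S (init (init G)) ∧ (last (init G) == not τ)

  lift₃ : VSet m → VSet (3 + m)
  lift₃ S G = S (init (init (init G))) ∧ ((last (init (init G)) == τ) ∧ (last G == τ))

  ∈lift₂ : (S : VSet (suc m)) (xs : Vec Bool (suc m)) (q r : Bool) →
    (xs ∷ʳ q ∷ʳ r) ∈ᵛ lift₂ S ⇔ (xs ∈ᵛ S × q ≡ not τ)
  ∈lift₂ S xs q r rewrite init-∷ʳ r (xs ∷ʳ q) | init-∷ʳ q xs | last-∷ʳ q xs =
    (⇔-id _ ×-⇔ ==⇔≡ q (not τ)) ⇔-∘ ∧⇔× (S xs) (q == not τ)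

  ∈lift₃ : (S : VSet m) (ys : Vec Bool m) (p q r : Bool) →
    (ys ∷ʳ p ∷ʳ q ∷ʳ r) ∈ᵛ lift₃ S ⇔ (ys ∈ᵛ S × p ≡ τ × r ≡ τ)
  ∈lift₃ S ys p q r
    rewrite init-∷ʳ r (ys ∷ʳ p ∷ʳ q) | init-∷ʳ q (ys ∷ʳ p) | init-∷ʳ p ys
          | last-∷ʳ p ys | last-∷ʳ r (ys ∷ʳ p ∷ʳ q) =
    (⇔-id _ ×-⇔ ((==⇔≡ p τ ×-⇔ ==⇔≡ r τ) ⇔-∘ ∧⇔× (p == τ) (r == τ))) ⇔-∘ ∧⇔× (S ys) ((p == τ) ∧ (r == τ))

  lift₂-resp : {S S′ : VSet (suc m)} → S ≗V S′ → lift₂ S ≗V lift₂ S′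
  lift₂-resp S≗S′ G = cong (_∧ (last (init G) == not τ)) (S≗S′ (init (init G)))

  lift₃-resp : {S S′ : VSet m} → S ≗V S′ → lift₃ S ≗V lift₃ S′
  lift₃-resp S≗S′ G = cong (_∧ ((last (init (init G)) == τ) ∧ (last G == τ))) (S≗S′ (init (init (init G))))

  lift₂-reflects : {S S′ : VSet (suc m)} → lift₂ S ≗V lift₂ S′ → S ≗V S′
  lift₂-reflects {S} {S′} L≗L′ xs = ≡true⇔⇒≡ (mk⇔ (transport S S′ L≗L′) (transport S′ S (sym ∘ L≗L′)))
    where
    transport : (S S′ : VSet (suc m)) → lift₂ S ≗V lift₂ S′ → xs ∈ᵛ S → xs ∈ᵛ S′
    transport S S′ L≗L′ p = proj₁ (to (∈lift₂ S′ xs (not τ) τ)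
      (trans (sym (L≗L′ (xs ∷ʳ not τ ∷ʳ τ))) (from (∈lift₂ S xs (not τ) τ) (p , refl))))

  lift₃-reflects : {S S′ : VSet m} → lift₃ S ≗V lift₃ S′ → S ≗V S′
  lift₃-reflects {S} {S′} L≗L′ ys = ≡true⇔⇒≡ (mk⇔ (transport S S′ L≗L′) (transport S′ S (sym ∘ L≗L′)))
    where
    transport : (S S′ : VSet m) → lift₃ S ≗V lift₃ S′ → ys ∈ᵛ S → ys ∈ᵛ S′
    transport S S′ L≗L′ p = proj₁ (to (∈lift₃ S′ ys τ τ τ)
      (trans (sym (L≗L′ (ys ∷ʳ τ ∷ʳ τ ∷ʳ τ))) (from (∈lift₃ S ys τ τ τ) (p , refl , refl))))

  lift₂≇lift₃ : {S : VSet (suc m)} {T : VSet m} {xs : Vec Bool (suc m)} → xs ∈ᵛ S → ¬ (lift₂ S ≗V lift₃ T)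
  lift₂≇lift₃ {S} {T} {xs} xs∈S L≗L′ with initLast xs
  ... | ys , p , refl = τ≢not-τ (sym (proj₂ (proj₂ (to (∈lift₃ T ys p (not τ) (not τ))
          (trans (sym (L≗L′ (ys ∷ʳ p ∷ʳ not τ ∷ʳ not τ)))
            (from (∈lift₂ S (ys ∷ʳ p) (not τ) (not τ)) (xs∈S , refl)))))))

  -- c is the base value of the freed coordinate, which does not affect the face.
  base₂ : Vec Bool (suc m) → Bool → Vec Bool (3 + m)
  base₂ b c = b ∷ʳ not τ ∷ʳ c

  dirs₂ : Vec Bool (suc m) → Vec Bool (3 + m)
  dirs₂ D = D ∷ʳ false ∷ʳ true

  base₃ : Vec Bool m → Bool → Vec Bool (3 + m)
  base₃ b c = b ∷ʳ τ ∷ʳ c ∷ʳ τ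

  dirs₃ : Vec Bool m → Vec Bool (3 + m)
  dirs₃ D = D ∷ʳ false ∷ʳ true ∷ʳ false

  weight-dirs₂ : (D : Vec Bool (suc m)) → weight (dirs₂ D) ≡ suc (weight D)
  weight-dirs₂ D = weight-∷ʳ² D false true

  weight-dirs₃ : (D : Vec Bool m) → weight (dirs₃ D) ≡ suc (weight D)
  weight-dirs₃ D = trans (weight-∷ʳ (D ∷ʳ false ∷ʳ true) false) (weight-∷ʳ² D false true)

  dirs₂-mono : {D E : Vec Bool (suc m)} → D ⊆ E → dirs₂ D ⊆ dirs₂ E
  dirs₂-mono {D} {E} D⊆E =
    from (⊆-∷ʳ (D ∷ʳ false) (E ∷ʳ false) true true) (from (⊆-∷ʳ D E false false) (D⊆E , λ ()) , λ _ → refl)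

  dirs₃-mono : {D E : Vec Bool m} → D ⊆ E → dirs₃ D ⊆ dirs₃ E
  dirs₃-mono {D} {E} D⊆E = from (⊆-∷ʳ (D ∷ʳ false ∷ʳ true) (E ∷ʳ false ∷ʳ true) false false)
    (from (⊆-∷ʳ (D ∷ʳ false) (E ∷ʳ false) true true) (from (⊆-∷ʳ D E false false) (D⊆E , λ ()) , λ _ → refl) ,
     λ ())

  ∈face₂ : (b D : Vec Bool (suc m)) (c : Bool) (xs : Vec Bool (suc m)) (q r : Bool) →
    (xs ∷ʳ q ∷ʳ r) ∈ᵛ face (base₂ b c) (dirs₂ D) ⇔ (xs ∈ᵛ face b D × q ≡ not τ)
  ∈face₂ b D c xs q r =
    ∈face-∷ʳ-fixed b D xs (not τ) q ⇔-∘ ∈face-∷ʳ-free (b ∷ʳ not τ) (D ∷ʳ false) (xs ∷ʳ q) c r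

  ∈face₃ : (b D : Vec Bool m) (c : Bool) (ys : Vec Bool m) (p q r : Bool) →
    (ys ∷ʳ p ∷ʳ q ∷ʳ r) ∈ᵛ face (base₃ b c) (dirs₃ D) ⇔ (ys ∈ᵛ face b D × p ≡ τ × r ≡ τ)
  ∈face₃ b D c ys p q r =
    ×-assocʳ ⇔-∘ (((∈face-∷ʳ-fixed b D ys τ p ⇔-∘ ∈face-∷ʳ-free (b ∷ʳ τ) (D ∷ʳ false) (ys ∷ʳ p) c q) ×-⇔ ⇔-id _)
      ⇔-∘ ∈face-∷ʳ-fixed (b ∷ʳ τ ∷ʳ c) (D ∷ʳ false ∷ʳ true) (ys ∷ʳ p ∷ʳ q) τ r)
    where
    ×-assocʳ : {X Y Z : Set} → ((X × Y) × Z) ⇔ (X × Y × Z)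
    ×-assocʳ = mk⇔ (λ { ((x , y) , z) → x , y , z }) (λ { (x , y , z) → (x , y) , z })

  face₂≗lift₂ : (b D : Vec Bool (suc m)) (c : Bool) → face (base₂ b c) (dirs₂ D) ≗V lift₂ (face b D)
  face₂≗lift₂ b D c = ∀∷ʳ² {P = λ G → face (base₂ b c) (dirs₂ D) G ≡ lift₂ (face b D) G}
    λ xs q r → ≡true⇔⇒≡ (⇔-sym (∈lift₂ (face b D) xs q r) ⇔-∘ ∈face₂ b D c xs q r)

  face₃≗lift₃ : (b D : Vec Bool m) (c : Bool) → face (base₃ b c) (dirs₃ D) ≗V lift₃ (face b D)
  face₃≗lift₃ b D c = ∀∷ʳ³ {P = λ G → face (base₃ b c) (dirs₃ D) G ≡ lift₃ (face b D) G}
    λ ys p q r → ≡true⇔⇒≡ (⇔-sym (∈lift₃ (face b D) ys p q r) ⇔-∘ ∈face₃ b D c ys p q r)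

  face-in-A₁⇔face₂-in-A₃ : (b D : Vec Bool (suc m)) (c : Bool) → FaceIn A₁ b D ⇔ FaceIn A₃ (base₂ b c) (dirs₂ D)
  face-in-A₁⇔face₂-in-A₃ b D c = mk⇔
    (λ inA → ∀∷ʳ² {P = λ G → G ∈ᵛ face (base₂ b c) (dirs₂ D) → A₃ G} λ xs q r G∈ →
      let xs∈ , q≡ = to (∈face₂ b D c xs q r) G∈ in
      subst (λ t → A₃ (xs ∷ʳ t ∷ʳ r)) (sym q≡) (A₁⇒A₃ (inA xs xs∈)))
    (λ inA₃ x x∈ → A₃⇒A₁ (inA₃ (x ∷ʳ not τ ∷ʳ c) (from (∈face₂ b D c x (not τ) c) (x∈ , refl))))

  face-in-A₀⇔face₃-in-A₃ : (b D : Vec Bool m) (c : Bool) → FaceIn A₀ b D ⇔ FaceIn A₃ (base₃ b c) (dirs₃ D)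
  face-in-A₀⇔face₃-in-A₃ b D c = mk⇔
    (λ inA → ∀∷ʳ³ {P = λ G → G ∈ᵛ face (base₃ b c) (dirs₃ D) → A₃ G} λ ys p q r G∈ →
      let ys∈ , p≡ , r≡ = to (∈face₃ b D c ys p q r) G∈ in
      subst₂ (λ s t → A₃ (ys ∷ʳ s ∷ʳ q ∷ʳ t)) (sym p≡) (sym r≡) (A₀⇒A₃ (inA ys ys∈)))
    (λ inA₃ x x∈ → A₃⇒A₀ (inA₃ (x ∷ʳ τ ∷ʳ c ∷ʳ τ) (from (∈face₃ b D c x τ c τ) (x∈ , refl , refl))))

  max-face-in-A₁⇔max-face₂-in-A₃ : (b D : Vec Bool (suc m)) (c : Bool) →
    MaxFaceIn A₁ b D ⇔ MaxFaceIn A₃ (base₂ b c) (dirs₂ D)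
  max-face-in-A₁⇔max-face₂-in-A₃ b D c = mk⇔
    (λ (inA , not-extendable) → to (face-in-A₁⇔face₂-in-A₃ b D c) inA ,
       ∀∷ʳ² {P = λ D₂ → dirs₂ D ⊆ D₂ → weight D₂ ≡ suc (weight (dirs₂ D)) → ¬ FaceIn A₃ (base₂ b c) D₂}
         (lifted-not-extendable not-extendable))
    (λ (inA₃ , not-extendable₃) → from (face-in-A₁⇔face₂-in-A₃ b D c) inA₃ ,
       λ E D⊆E weight-E inA → not-extendable₃ (dirs₂ E) (dirs₂-mono {D} {E} D⊆E)
         (trans (weight-dirs₂ E) (cong suc (trans weight-E (sym (weight-dirs₂ D)))))
         (to (face-in-A₁⇔face₂-in-A₃ b E c) inA))
    where
    lifted-not-extendable : (∀ E → D ⊆ E → weight E ≡ suc (weight D) → ¬ FaceIn A₁ b E) →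
      ∀ E eq er → dirs₂ D ⊆ E ∷ʳ eq ∷ʳ er → weight (E ∷ʳ eq ∷ʳ er) ≡ suc (weight (dirs₂ D)) →
      ¬ FaceIn A₃ (base₂ b c) (E ∷ʳ eq ∷ʳ er)
    lifted-not-extendable not-extendable E eq er D⊆E weight-E inA₃
      with to (⊆-∷ʳ (D ∷ʳ false) (E ∷ʳ eq) true er) D⊆E
    ... | D∷⊆E∷ , r-free with er | r-free refl
    ... | true | _ with eq
    ...   | true = ¬A₃-q-active-r-inactive (inA₃ (b ∷ʳ τ ∷ʳ not τ)
                     (from (∈face-∷ʳ-free (b ∷ʳ not τ) (E ∷ʳ true) (b ∷ʳ τ) c (not τ))
                       (from (∈face-∷ʳ-free b E b (not τ) τ) (base∈face b E))))
    ...   | false = not-extendable E (proj₁ (to (⊆-∷ʳ D E false false) D∷⊆E∷))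
                      (suc-injective (trans (sym (weight-dirs₂ E)) (trans weight-E (cong suc (weight-dirs₂ D)))))
                      (from (face-in-A₁⇔face₂-in-A₃ b E c) inA₃)

  max-face-in-A₀⇔max-face₃-in-A₃ : (b D : Vec Bool m) (c : Bool) →
    MaxFaceIn A₀ b D ⇔ MaxFaceIn A₃ (base₃ b c) (dirs₃ D)
  max-face-in-A₀⇔max-face₃-in-A₃ b D c = mk⇔
    (λ (inA , not-extendable) → to (face-in-A₀⇔face₃-in-A₃ b D c) inA ,
       ∀∷ʳ³ {P = λ D₂ → dirs₃ D ⊆ D₂ → weight D₂ ≡ suc (weight (dirs₃ D)) → ¬ FaceIn A₃ (base₃ b c) D₂}
         (lifted-not-extendable not-extendable))
    (λ (inA₃ , not-extendable₃) → from (face-in-A₀⇔face₃-in-A₃ b D c) inA₃ ,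
       λ E D⊆E weight-E inA → not-extendable₃ (dirs₃ E) (dirs₃-mono {D} {E} D⊆E)
         (trans (weight-dirs₃ E) (cong suc (trans weight-E (sym (weight-dirs₃ D)))))
         (to (face-in-A₀⇔face₃-in-A₃ b E c) inA))
    where
    lifted-not-extendable : (∀ E → D ⊆ E → weight E ≡ suc (weight D) → ¬ FaceIn A₀ b E) →
      ∀ E ep eq er → dirs₃ D ⊆ E ∷ʳ ep ∷ʳ eq ∷ʳ er → weight (E ∷ʳ ep ∷ʳ eq ∷ʳ er) ≡ suc (weight (dirs₃ D)) →
      ¬ FaceIn A₃ (base₃ b c) (E ∷ʳ ep ∷ʳ eq ∷ʳ er)
    lifted-not-extendable not-extendable E ep eq er D⊆E weight-E inA₃
      with to (⊆-∷ʳ (D ∷ʳ false) (E ∷ʳ ep) true eq)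
             (proj₁ (to (⊆-∷ʳ (D ∷ʳ false ∷ʳ true) (E ∷ʳ ep ∷ʳ eq) false er) D⊆E))
    ... | D∷⊆E∷ , q-free with eq | q-free refl
    ... | true | _ with ep | er
    ...   | true | er′ = ¬A₃-p-inactive-q-active (inA₃ (b ∷ʳ not τ ∷ʳ τ ∷ʳ τ)
                         (∈face-∷ʳ-base (b ∷ʳ τ ∷ʳ c) (E ∷ʳ true ∷ʳ true) (b ∷ʳ not τ ∷ʳ τ) τ er′
                           (from (∈face-∷ʳ-free (b ∷ʳ τ) (E ∷ʳ true) (b ∷ʳ not τ) c τ)
                             (from (∈face-∷ʳ-free b E b τ (not τ)) (base∈face b E)))))
    ...   | false | true = ¬A₃-q-active-r-inactive (inA₃ (b ∷ʳ τ ∷ʳ τ ∷ʳ not τ)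
                             (from (∈face-∷ʳ-free (b ∷ʳ τ ∷ʳ c) (E ∷ʳ false ∷ʳ true) (b ∷ʳ τ ∷ʳ τ) τ (not τ))
                               (from (∈face-∷ʳ-free (b ∷ʳ τ) (E ∷ʳ false) (b ∷ʳ τ) c τ)
                                 (∈face-∷ʳ-base b E b τ false (base∈face b E)))))
    ...   | false | false = not-extendable E (proj₁ (to (⊆-∷ʳ D E false false) D∷⊆E∷))
                              (suc-injective (trans (sym (weight-dirs₃ E)) (trans weight-E (cong suc (weight-dirs₃ D)))))
                              (from (face-in-A₀⇔face₃-in-A₃ b E c) inA₃)

  Lifted : ℕ → VSet (3 + m) → Set
  Lifted k S = (Σ (VSet (suc m)) λ S₂ → IsMaxCubeOf A₁ k S₂ × S ≗V lift₂ S₂)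
             ⊎ (Σ (VSet m) λ S₃ → IsMaxCubeOf A₀ k S₃ × S ≗V lift₃ S₃)

  Lifted-resp : ∀ {k} {S T : VSet (3 + m)} → S ≗V T → Lifted k T → Lifted k S
  Lifted-resp S≗T (inj₁ (S₂ , max₂ , T≗)) = inj₁ (S₂ , max₂ , λ x → trans (S≗T x) (T≗ x))
  Lifted-resp S≗T (inj₂ (S₃ , max₃ , T≗)) = inj₂ (S₃ , max₃ , λ x → trans (S≗T x) (T≗ x))

  q-and-r-fixed⇒not-max : ∀ Bx bq br Dx → ¬ MaxFaceIn A₃ (Bx ∷ʳ bq ∷ʳ br) (Dx ∷ʳ false ∷ʳ false)
  q-and-r-fixed⇒not-max Bx bq br Dx (inA₃ , not-extendable) with τ-or-not-τ bq
  ... | inj₂ refl = not-extendable (dirs₂ Dx)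
    (from (⊆-∷ʳ (Dx ∷ʳ false) (Dx ∷ʳ false) false true) (⊆-refl (Dx ∷ʳ false) , λ _ → refl))
    (trans (weight-dirs₂ Dx) (cong suc (sym (weight-∷ʳ² Dx false false))))
    (to (face-in-A₁⇔face₂-in-A₃ Bx Dx br) λ x x∈ → A₃⇒A₁ (inA₃ (x ∷ʳ not τ ∷ʳ br)
      (∈face-∷ʳ-base (Bx ∷ʳ not τ) (Dx ∷ʳ false) (x ∷ʳ not τ) br false (∈face-∷ʳ-base Bx Dx x (not τ) false x∈))))
  ... | inj₁ refl = not-extendable (Dx ∷ʳ true ∷ʳ false)
    (from (⊆-∷ʳ (Dx ∷ʳ false) (Dx ∷ʳ true) false false)
      (from (⊆-∷ʳ Dx Dx false true) (⊆-refl Dx , λ _ → refl) , λ ()))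
    (trans (weight-∷ʳ² Dx true false) (cong suc (sym (weight-∷ʳ² Dx false false))))
    (∀∷ʳ² {P = λ G → G ∈ᵛ face (Bx ∷ʳ τ ∷ʳ br) (Dx ∷ʳ true ∷ʳ false) → A₃ G} q-free)
    where
    q-free : ∀ xs q r → (xs ∷ʳ q ∷ʳ r) ∈ᵛ face (Bx ∷ʳ τ ∷ʳ br) (Dx ∷ʳ true ∷ʳ false) → A₃ (xs ∷ʳ q ∷ʳ r)
    q-free xs q r G∈ =
      let xsq∈ , r≡br = to (∈face-∷ʳ-fixed (Bx ∷ʳ τ) (Dx ∷ʳ true) (xs ∷ʳ q) br r) G∈
          xs∈ = to (∈face-∷ʳ-free Bx Dx xs τ q) xsq∈
          A₁xs , p-active , r-active = to (A₃⇔ xs τ br) (inA₃ (xs ∷ʳ τ ∷ʳ br)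
            (∈face-∷ʳ-base (Bx ∷ʳ τ) (Dx ∷ʳ false) (xs ∷ʳ τ) br false (∈face-∷ʳ-base Bx Dx xs τ false xs∈)))
      in from (A₃⇔ xs q r) (A₁xs , (λ _ → p-active refl) , λ _ → trans r≡br (r-active refl))

  max-face-classification : ∀ k Bx bq br Dx dq dr → weight (Dx ∷ʳ dq ∷ʳ dr) ≡ suc k →
    MaxFaceIn A₃ (Bx ∷ʳ bq ∷ʳ br) (Dx ∷ʳ dq ∷ʳ dr) → Lifted k (face (Bx ∷ʳ bq ∷ʳ br) (Dx ∷ʳ dq ∷ʳ dr))
  max-face-classification k Bx bq br Dx false false _ max-face =
    ⊥-elim (q-and-r-fixed⇒not-max Bx bq br Dx max-face)
  max-face-classification k Bx bq br Dx true true _ (inA₃ , _) =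
    ⊥-elim (¬A₃-q-active-r-inactive (inA₃ (Bx ∷ʳ τ ∷ʳ not τ)
      (from (∈face-∷ʳ-free (Bx ∷ʳ bq) (Dx ∷ʳ true) (Bx ∷ʳ τ) br (not τ))
        (from (∈face-∷ʳ-free Bx Dx Bx bq τ) (base∈face Bx Dx)))))
  max-face-classification k Bx bq br Dx false true weight-D max-face with τ-or-not-τ bq
  ... | inj₁ refl = ⊥-elim (¬A₃-q-active-r-inactive (proj₁ max-face (Bx ∷ʳ τ ∷ʳ not τ)
      (from (∈face-∷ʳ-free (Bx ∷ʳ τ) (Dx ∷ʳ false) (Bx ∷ʳ τ) br (not τ))
        (∈face-∷ʳ-base Bx Dx Bx τ false (base∈face Bx Dx)))))
  ... | inj₂ refl = inj₁ (face Bx Dx ,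
      max-face-is-max-cube Bx Dx (suc-injective (trans (sym (weight-dirs₂ Dx)) weight-D))
        (from (max-face-in-A₁⇔max-face₂-in-A₃ Bx Dx br) max-face) ,
      face₂≗lift₂ Bx Dx br)
  max-face-classification k Bx bq br Dx true false weight-D max-face with initLast Bx | initLast Dx
  ... | b , bp , refl | D , true , refl =
    ⊥-elim (¬A₃-p-inactive-q-active (proj₁ max-face (b ∷ʳ not τ ∷ʳ τ ∷ʳ br)
      (∈face-∷ʳ-base (b ∷ʳ bp ∷ʳ bq) (D ∷ʳ true ∷ʳ true) (b ∷ʳ not τ ∷ʳ τ) br false
        (from (∈face-∷ʳ-free (b ∷ʳ bp) (D ∷ʳ true) (b ∷ʳ not τ) bq τ)
          (from (∈face-∷ʳ-free b D b bp (not τ)) (base∈face b D))))))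
  ... | b , bp , refl | D , false , refl
    with to (A₃⇔ (b ∷ʳ bp) τ br) (proj₁ max-face (b ∷ʳ bp ∷ʳ τ ∷ʳ br)
      (∈face-∷ʳ-base (b ∷ʳ bp ∷ʳ bq) (D ∷ʳ false ∷ʳ true) (b ∷ʳ bp ∷ʳ τ) br false
        (from (∈face-∷ʳ-free (b ∷ʳ bp) (D ∷ʳ false) (b ∷ʳ bp) bq τ)
          (∈face-∷ʳ-base b D b bp false (base∈face b D)))))
  ... | _ , p-active , r-active with trans (sym (last-∷ʳ bp b)) (p-active refl) | r-active refl
  ... | refl | refl = inj₂ (face b D ,
      max-face-is-max-cube b D (suc-injective (trans (sym (weight-dirs₃ D)) weight-D))
        (from (max-face-in-A₀⇔max-face₃-in-A₃ b D bq) max-face) ,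
      face₃≗lift₃ b D bq)

  max-cube-classification : ∀ {k} {S : VSet (3 + m)} → IsMaxCubeOf A₃ (suc k) S → Lifted k S
  max-cube-classification {k} max-cube with max-cube-is-max-face max-cube
  ... | B , D′ , weight-D′ , S≗face , max-face = Lifted-resp S≗face
    (∀∷ʳ² {P = λ B → ∀ D′ → weight D′ ≡ suc k → MaxFaceIn A₃ B D′ → Lifted k (face B D′)}
      (λ Bx bq br → ∀∷ʳ² {P = λ D′ → weight D′ ≡ suc k → MaxFaceIn A₃ (Bx ∷ʳ bq ∷ʳ br) D′ →
                                       Lifted k (face (Bx ∷ʳ bq ∷ʳ br) D′)}
        (max-face-classification k Bx bq br))
      B D′ weight-D′ max-face)

  no-max-vertex : ∀ {S : VSet (3 + m)} → ¬ IsMaxCubeOf A₃ 0 S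
  no-max-vertex max-cube with max-cube-is-max-face max-cube
  ... | B , D′ , weight-D′ , _ , max-face =
    ∀∷ʳ² {P = λ B → ∀ D′ → weight D′ ≡ 0 → ¬ MaxFaceIn A₃ B D′}
      (λ Bx bq br → ∀∷ʳ² {P = λ D′ → weight D′ ≡ 0 → ¬ MaxFaceIn A₃ (Bx ∷ʳ bq ∷ʳ br) D′}
        λ Dx dq dr weight≡0 → vertex Bx bq br Dx dq dr (trans (sym (weight-∷ʳ² Dx dq dr)) weight≡0))
      B D′ weight-D′ max-face
    where
    vertex : ∀ Bx bq br Dx dq dr → weight (dr ∷ dq ∷ Dx) ≡ 0 →
      ¬ MaxFaceIn A₃ (Bx ∷ʳ bq ∷ʳ br) (Dx ∷ʳ dq ∷ʳ dr)
    vertex Bx bq br Dx false false _ = q-and-r-fixed⇒not-max Bx bq br Dx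

  lift₂-max : ∀ {k} {S : VSet (suc m)} → IsMaxCubeOf A₁ k S → IsMaxCubeOf A₃ (suc k) (lift₂ S)
  lift₂-max max-cube with max-cube-is-max-face max-cube
  ... | b , D , weight-D , S≗face , max-face =
    max-cube-resp {A = A₃} (λ G → trans (face₂≗lift₂ b D false G) (lift₂-resp (sym ∘ S≗face) G))
      (max-face-is-max-cube (base₂ b false) (dirs₂ D) (trans (weight-dirs₂ D) (cong suc weight-D))
        (to (max-face-in-A₁⇔max-face₂-in-A₃ b D false) max-face))

  lift₃-max : ∀ {k} {S : VSet m} → IsMaxCubeOf A₀ k S → IsMaxCubeOf A₃ (suc k) (lift₃ S)
  lift₃-max max-cube with max-cube-is-max-face max-cube
  ... | b , D , weight-D , S≗face , max-face =
    max-cube-resp {A = A₃} (λ G → trans (face₃≗lift₃ b D false G) (lift₃-resp (sym ∘ S≗face) G))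
      (max-face-is-max-cube (base₃ b false) (dirs₃ D) (trans (weight-dirs₃ D) (cong suc weight-D))
        (to (max-face-in-A₀⇔max-face₃-in-A₃ b D false) max-face))

  max-cube-count : ∀ k a c → MaxCubeCount A₁ k a → MaxCubeCount A₀ k c → MaxCubeCount A₃ (suc k) (a + c)
  max-cube-count k a c (cube₂ , max₂ , distinct₂ , complete₂) (cube₃ , max₃ , distinct₃ , complete₃) =
    cube ∘ splitAt a , max ∘ splitAt a , distinct , complete
    where
    cube : Fin a ⊎ Fin c → VSet (3 + m)
    cube (inj₁ i) = lift₂ (cube₂ i)
    cube (inj₂ j) = lift₃ (cube₃ j)

    max : ∀ s → IsMaxCubeOf A₃ (suc k) (cube s)
    max (inj₁ i) = lift₂-max (max₂ i)
    max (inj₂ j) = lift₃-max (max₃ j)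

    cube₂-nonempty : ∀ i → ∃ λ xs → xs ∈ᵛ cube₂ i
    cube₂-nonempty i = cube-nonempty {A = A₁} (proj₁ (max₂ i))

    cube-distinct : ∀ s t → cube s ≗V cube t → s ≡ t
    cube-distinct (inj₁ i) (inj₁ j) e = cong inj₁ (distinct₂ i j (lift₂-reflects e))
    cube-distinct (inj₂ i) (inj₂ j) e = cong inj₂ (distinct₃ i j (lift₃-reflects e))
    cube-distinct (inj₁ i) (inj₂ j) e = ⊥-elim (lift₂≇lift₃ {S = cube₂ i} {T = cube₃ j} (proj₂ (cube₂-nonempty i)) e)
    cube-distinct (inj₂ i) (inj₁ j) e = ⊥-elim (lift₂≇lift₃ {S = cube₂ j} {T = cube₃ i} (proj₂ (cube₂-nonempty j)) (sym ∘ e))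

    distinct : ∀ i j → cube (splitAt a i) ≗V cube (splitAt a j) → i ≡ j
    distinct i j e = begin
      i                       ≡⟨ join-splitAt a c i ⟨
      join a c (splitAt a i)  ≡⟨ cong (join a c) (cube-distinct (splitAt a i) (splitAt a j) e) ⟩
      join a c (splitAt a j)  ≡⟨ join-splitAt a c j ⟩
      j                       ∎
      where open ≡-Reasoning

    complete : ∀ S → IsMaxCubeOf A₃ (suc k) S → ∃ λ i → S ≗V cube (splitAt a i)
    complete S max-cube with max-cube-classification max-cube
    ... | inj₁ (S₂ , max-S₂ , S≗) = let i , S₂≗ = complete₂ S₂ max-S₂ in
      join a c (inj₁ i) , λ x → trans (S≗ x) (trans (lift₂-resp S₂≗ x)
        (cong (λ s → cube s x) (sym (splitAt-join a c (inj₁ i)))))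
    ... | inj₂ (S₃ , max-S₃ , S≗) = let j , S₃≗ = complete₃ S₃ max-S₃ in
      join a c (inj₂ j) , λ x → trans (S≗ x) (trans (lift₃-resp S₃≗ x)
        (cong (λ s → cube s x) (sym (splitAt-join a c (inj₂ j)))))

  no-max-vertices : ∀ c → MaxCubeCount A₃ 0 c → c ≡ 0
  no-max-vertices zero    _                 = refl
  no-max-vertices (suc c) (_ , max , _ , _) = ⊥-elim (no-max-vertex (max fzero))

-- The S-fence

even : ℕ → Bool
even zero          = true
even (suc zero)    = false
even (suc (suc n)) = even n

even-suc : ∀ n → even (suc n) ≡ not (even n)
even-suc zero          = refl
even-suc (suc zero)    = refl
even-suc (suc (suc n)) = even-suc n

even-double : ∀ k → even (2 * k) ≡ true
even-double zero    = refl
even-double (suc k) = trans (cong even (*-suc 2 k)) (even-double k)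

even-suc-double : ∀ k → even (suc (2 * k)) ≡ false
even-suc-double zero    = refl
even-suc-double (suc k) = trans (cong (even ∘ suc) (*-suc 2 k)) (even-suc-double k)

even⇒double : ∀ t → even t ≡ true → ∃ λ k → t ≡ 2 * k
even⇒double zero          _ = 0 , refl
even⇒double (suc (suc t)) e = let k , t≡2k = even⇒double t e in
  suc k , trans (cong (suc ∘ suc) t≡2k) (sym (*-suc 2 k))

odd⇒suc-double : ∀ t → even t ≡ false → ∃ λ k → t ≡ suc (2 * k)
odd⇒suc-double (suc zero)    _ = 0 , refl
odd⇒suc-double (suc (suc t)) e = let k , t≡ = odd⇒suc-double t e in
  suc k , trans (cong (suc ∘ suc) t≡) (cong suc (sym (*-suc 2 k)))

suc-pred-double : ∀ k → suc (2 * suc k ∸ 1) ≡ 2 * suc k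
suc-pred-double k = subst (λ t → suc (t ∸ 1) ≡ t) (sym (*-suc 2 k)) refl

cover-upward : ∀ {i j} → Cover i j → i < j → even j ≡ true × (j ≡ 4 ⊎ suc i ≡ j)
cover-upward c21              (s≤s ())
cover-upward c32              (s≤s (s≤s ()))
cover-upward c54              (s≤s (s≤s (s≤s (s≤s ()))))
cover-upward c24              _  = refl , inj₁ refl
cover-upward (codd (suc k) _) _  = even-double (suc k) , inj₂ (suc-pred-double k)
cover-upward (ceve k _)       lt = ⊥-elim (<-asym lt (n<1+n (2 * k)))

cover-downward : ∀ {i j} → Cover i j → j < i → i ≡ 2 ⊎ (even i ≡ false × suc j ≡ i)
cover-downward c21         _  = inj₁ refl
cover-downward c32         _  = inj₂ (refl , refl)
cover-downward c54         _  = inj₂ (refl , refl)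
cover-downward c24         (s≤s (s≤s ()))
cover-downward (codd k _)  lt = ⊥-elim (<-irrefl refl (<-≤-trans lt (m∸n≤m (2 * k) 1)))
cover-downward (ceve k _)  _  = inj₂ (even-suc-double k , refl)

cover-irrefl : ∀ {i j} → Cover i j → i ≢ j
cover-irrefl (codd (suc k) _) e = <⇒≢ (n<1+n _) (sym (trans (suc-pred-double k) (sym e)))
cover-irrefl (ceve k _)       e = <⇒≢ (n<1+n (2 * k)) (sym e)

cover-into-even : ∀ t → 5 ≤ t → even t ≡ true → Cover (pred t) t
cover-into-even t 5≤t e with even⇒double t e
cover-into-even _ (s≤s (s≤s ())) _ | 1 , refl
cover-into-even _ (s≤s (s≤s (s≤s (s≤s ())))) _ | 2 , refl
cover-into-even _ _ _ | suc (suc (suc k)) , refl = codd (3 + k) (s≤s (s≤s (s≤s z≤n)))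

cover-from-odd : ∀ t → 5 ≤ t → even t ≡ false → Cover t (pred t)
cover-from-odd t 5≤t e with odd⇒suc-double t e
cover-from-odd _ (s≤s (s≤s (s≤s ()))) _ | 1 , refl
cover-from-odd _ _ _ | 2 , refl = c54
cover-from-odd _ _ _ | suc (suc (suc k)) , refl = ceve (3 + k) (s≤s (s≤s (s≤s z≤n)))

CoverClosed : (N : ℕ) → Vec Bool N → Set
CoverClosed N F = ∀ a b → Cov N a b → lookup F a ≡ true → lookup F b ≡ true

filter⇔cover-closed : ∀ {N} (F : Vec Bool N) → IsFilter N F ⇔ CoverClosed N F
filter⇔cover-closed {N} F = mk⇔
  (λ filter a b a⋖b a∈F → []=⇒lookup (filter a b (a⋖b ◅ ε) (lookup⇒[]= a F a∈F)))
  (λ closed a b a≤b a∈F → lookup⇒[]= b F (along closed a≤b ([]=⇒lookup a∈F)))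
  where
  along : CoverClosed N F → ∀ {a b} → Star (Cov N) a b → lookup F a ≡ true → lookup F b ≡ true
  along closed ε        p = p
  along closed (c ◅ cs) p = along closed cs (closed _ _ c p)

data SnocView {N : ℕ} : Fin (suc N) → Set where
  old : (a : Fin N) → SnocView (inject₁ a)
  new : SnocView (fromℕ N)

snoc-view : ∀ {N} (a : Fin (suc N)) → SnocView a
snoc-view {zero}  fzero    = new
snoc-view {suc N} fzero    = old fzero
snoc-view {suc N} (fsuc a) with snoc-view a
... | old a′ = old (fsuc a′)
... | new    = new

lookup-∷ʳ-inject₁ : ∀ {A : Set} {N} (xs : Vec A N) x a → lookup (xs ∷ʳ x) (inject₁ a) ≡ lookup xs a
lookup-∷ʳ-inject₁ (_ ∷ xs) x fzero    = refl
lookup-∷ʳ-inject₁ (_ ∷ xs) x (fsuc a) = lookup-∷ʳ-inject₁ xs x a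

lookup-∷ʳ-fromℕ : ∀ {A : Set} {N} (xs : Vec A N) x → lookup (xs ∷ʳ x) (fromℕ N) ≡ x
lookup-∷ʳ-fromℕ []       x = refl
lookup-∷ʳ-fromℕ (_ ∷ xs) x = lookup-∷ʳ-fromℕ xs x

lookup-fromℕ≡last : ∀ {A : Set} {N} (xs : Vec A (suc N)) → lookup xs (fromℕ N) ≡ last xs
lookup-fromℕ≡last xs with initLast xs
... | ys , y , refl = lookup-∷ʳ-fromℕ ys y

BelowNew AboveNew : (N : ℕ) → Vec Bool N → Bool → Set
BelowNew N xs x = ∀ a → Cover (suc (toℕ a)) (suc N) → lookup xs a ≡ true → x ≡ true
AboveNew N xs x = ∀ a → Cover (suc N) (suc (toℕ a)) → x ≡ true → lookup xs a ≡ true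

cover-closed-∷ʳ : ∀ {N} (xs : Vec Bool N) x →
  CoverClosed (suc N) (xs ∷ʳ x) ⇔ (CoverClosed N xs × BelowNew N xs x × AboveNew N xs x)
cover-closed-∷ʳ {N} xs x = mk⇔
  (λ closed →
    (λ a b c p → trans (sym (lookup-∷ʳ-inject₁ xs x b)) (closed (inject₁ a) (inject₁ b)
      (subst₂ Cover (old-index a) (old-index b) c) (trans (lookup-∷ʳ-inject₁ xs x a) p))) ,
    (λ a c p → trans (sym (lookup-∷ʳ-fromℕ xs x)) (closed (inject₁ a) (fromℕ N)
      (subst₂ Cover (old-index a) new-index c) (trans (lookup-∷ʳ-inject₁ xs x a) p))) ,
    (λ a c p → trans (sym (lookup-∷ʳ-inject₁ xs x a)) (closed (fromℕ N) (inject₁ a)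
      (subst₂ Cover new-index (old-index a) c) (trans (lookup-∷ʳ-fromℕ xs x) p))))
  (λ (closed , below , above) a b c p → glue closed below above (snoc-view a) (snoc-view b) c p)
  where
  old-index : (a : Fin N) → suc (toℕ a) ≡ suc (toℕ (inject₁ a))
  old-index a = cong suc (sym (toℕ-inject₁ a))

  new-index : suc N ≡ suc (toℕ (fromℕ N))
  new-index = cong suc (sym (toℕ-fromℕ N))

  glue : CoverClosed N xs → BelowNew N xs x → AboveNew N xs x → ∀ {a b} → SnocView a → SnocView b →
    Cov (suc N) a b → lookup (xs ∷ʳ x) a ≡ true → lookup (xs ∷ʳ x) b ≡ true
  glue closed _ _ (old a) (old b) c p = trans (lookup-∷ʳ-inject₁ xs x b) (closed a b
    (subst₂ Cover (sym (old-index a)) (sym (old-index b)) c) (trans (sym (lookup-∷ʳ-inject₁ xs x a)) p))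
  glue _ below _ (old a) new c p = trans (lookup-∷ʳ-fromℕ xs x) (below a
    (subst₂ Cover (sym (old-index a)) (sym new-index) c) (trans (sym (lookup-∷ʳ-inject₁ xs x a)) p))
  glue _ _ above new (old b) c p = trans (lookup-∷ʳ-inject₁ xs x b) (above b
    (subst₂ Cover (sym new-index) (sym (old-index b)) c) (trans (sym (lookup-∷ʳ-fromℕ xs x)) p))
  glue _ _ _ new new c _ = ⊥-elim (cover-irrefl c refl)

index<suc : ∀ {N} (a : Fin N) → suc (toℕ a) < suc N
index<suc a = s≤s (toℕ<n a)

-- From x₄ on the fence alternates, so x_t is maximal in φ_t for even t and minimal for odd t.
filter-∷ʳ-extremal : ∀ N (xs : Vec Bool N) → 4 ≤ suc N →
  IsFilter (suc N) (xs ∷ʳ even (suc N)) ⇔ IsFilter N xs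
filter-∷ʳ-extremal N xs 4≤t = mk⇔
  (λ F → from (filter⇔cover-closed xs)
    (proj₁ (to (cover-closed-∷ʳ xs _) (to (filter⇔cover-closed _) F))))
  (λ F → from (filter⇔cover-closed _) (from (cover-closed-∷ʳ xs _)
    (to (filter⇔cover-closed xs) F , below , above)))
  where
  below : BelowNew N xs (even (suc N))
  below a c _ = proj₁ (cover-upward c (index<suc a))

  above : AboveNew N xs (even (suc N))
  above a c t-even with cover-downward c (index<suc a)
  ... | inj₁ t≡2         = ⊥-elim (4≰2 (subst (4 ≤_) t≡2 4≤t))
    where
    4≰2 : ¬ 4 ≤ 2
    4≰2 (s≤s (s≤s ()))
  ... | inj₂ (t-odd , _) = ⊥-elim (not-¬ t-even t-odd)

-- For t ≥ 5 the only earlier neighbour of x_t is x_{t-1}, below x_t for even t and above it for odd t.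
filter-∷ʳ-link : ∀ N (xs : Vec Bool (suc N)) x → 5 ≤ 2 + N →
  IsFilter (2 + N) (xs ∷ʳ x) ⇔ (IsFilter (suc N) xs × (last xs ≡ even (2 + N) → x ≡ even (2 + N)))
filter-∷ʳ-link N xs x 5≤t = mk⇔
  (λ F → let closed , neighbours = to (cover-closed-∷ʳ xs x) (to (filter⇔cover-closed _) F) in
    from (filter⇔cover-closed xs) closed , to link neighbours)
  (λ (F , imp) → from (filter⇔cover-closed _) (from (cover-closed-∷ʳ xs x)
    (to (filter⇔cover-closed xs) F , from link imp)))
  where
  5≰4 : ¬ 5 ≤ 4
  5≰4 (s≤s (s≤s (s≤s (s≤s ()))))

  t≢2 : 2 + N ≢ 2
  t≢2 t≡2 = 5≰2 (subst (5 ≤_) t≡2 5≤t)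
    where
    5≰2 : ¬ 5 ≤ 2
    5≰2 (s≤s (s≤s ()))

  is-last : ∀ a → suc (toℕ a) ≡ suc N → lookup xs a ≡ last xs
  is-last a e =
    trans (cong (lookup xs) (toℕ-injective (trans (suc-injective e) (sym (toℕ-fromℕ N))))) (lookup-fromℕ≡last xs)

  last-index : ∀ {i j} → i ≡ j → Cover (suc i) (2 + N) → Cover (suc j) (2 + N)
  last-index refl c = c

  link-even : even (2 + N) ≡ true →
    (BelowNew (suc N) xs x × AboveNew (suc N) xs x) ⇔ (last xs ≡ true → x ≡ true)
  link-even e = mk⇔
    (λ (below , _) l → below (fromℕ N) (last-index (sym (toℕ-fromℕ N)) (cover-into-even (2 + N) 5≤t e))
      (trans (lookup-fromℕ≡last xs) l))
    (λ imp → below imp , above)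
    where
    below : (last xs ≡ true → x ≡ true) → BelowNew (suc N) xs x
    below imp a c p with cover-upward c (index<suc a)
    ... | _ , inj₁ t≡4 = ⊥-elim (5≰4 (subst (5 ≤_) t≡4 5≤t))
    ... | _ , inj₂ e′  = imp (trans (sym (is-last a (suc-injective e′))) p)

    above : AboveNew (suc N) xs x
    above a c _ with cover-downward c (index<suc a)
    ... | inj₁ t≡2         = ⊥-elim (t≢2 t≡2)
    ... | inj₂ (t-odd , _) = ⊥-elim (not-¬ e t-odd)

  link-odd : even (2 + N) ≡ false →
    (BelowNew (suc N) xs x × AboveNew (suc N) xs x) ⇔ (last xs ≡ false → x ≡ false)
  link-odd e = mk⇔
    (λ (_ , above) → contraposeᵇ λ x≡true → trans (sym (lookup-fromℕ≡last xs)) (above (fromℕ N)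
      (subst (Cover (2 + N)) (cong suc (sym (toℕ-fromℕ N))) (cover-from-odd (2 + N) 5≤t e)) x≡true))
    (λ imp → below , above imp)
    where
    below : BelowNew (suc N) xs x
    below a c _ = ⊥-elim (not-¬ (proj₁ (cover-upward c (index<suc a))) e)

    above : (last xs ≡ false → x ≡ false) → AboveNew (suc N) xs x
    above imp a c x≡true with cover-downward c (index<suc a)
    ... | inj₁ t≡2      = ⊥-elim (t≢2 t≡2)
    ... | inj₂ (_ , e′) = trans (is-last a (suc-injective e′)) (contraposeᵇ imp x≡true)

  link : (BelowNew (suc N) xs x × AboveNew (suc N) xs x) ⇔ (last xs ≡ even (2 + N) → x ≡ even (2 + N))
  link with even N in e
  ... | true  = link-even e
  ... | false = link-odd e

S-fence-tail : ∀ m → 6 ≤ 3 + m → let τ = even (3 + m) in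
    (∀ xs q r → IsFilter (3 + m) (xs ∷ʳ q ∷ʳ r) ⇔ (IsFilter (suc m) xs × (q ≡ τ → last xs ≡ τ) × (q ≡ τ → r ≡ τ)))
  × (∀ ys → IsFilter (suc m) (ys ∷ʳ τ) ⇔ IsFilter m ys)
S-fence-tail m 6≤n = tail , λ ys → filter-∷ʳ-extremal m ys (≤-pred (≤-pred 6≤n))
  where
  τ : Bool
  τ = even (3 + m)

  p-link : ∀ (xs : Vec Bool (suc m)) q → (last xs ≡ even (2 + m) → q ≡ even (2 + m)) ⇔ (q ≡ τ → last xs ≡ τ)
  p-link xs q =
    subst (λ t → (last xs ≡ even m → q ≡ even m) ⇔ (q ≡ t → last xs ≡ t)) (sym (even-suc m)) contrapose-⇔

  tail : ∀ xs q r → IsFilter (3 + m) (xs ∷ʳ q ∷ʳ r) ⇔ (IsFilter (suc m) xs × (q ≡ τ → last xs ≡ τ) × (q ≡ τ → r ≡ τ))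
  tail xs q r = mk⇔
    (λ F → let F₂ , r-linked = to link-r F
               F₁ , q-linked = to link-q F₂
           in F₁ , to (p-link xs q) q-linked , λ q≡τ → r-linked (trans (last-∷ʳ q xs) q≡τ))
    (λ (F₁ , p-active , r-active) → from link-r
      (from link-q (F₁ , from (p-link xs q) p-active) , λ last≡τ → r-active (trans (sym (last-∷ʳ q xs)) last≡τ)))
    where
    link-r : IsFilter (3 + m) (xs ∷ʳ q ∷ʳ r) ⇔ (IsFilter (2 + m) (xs ∷ʳ q) × (last (xs ∷ʳ q) ≡ τ → r ≡ τ))
    link-r = filter-∷ʳ-link (suc m) (xs ∷ʳ q) r (≤-trans (n≤1+n 5) 6≤n)

    link-q : IsFilter (2 + m) (xs ∷ʳ q) ⇔ (IsFilter (suc m) xs × (last xs ≡ even (2 + m) → q ≡ even (2 + m)))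
    link-q = filter-∷ʳ-link m xs q (≤-pred 6≤n)

proposition7 : ∀ n → 6 ≤ n →
    (∀ m → n , 0 ≋h m → m ≡ 0)
    × (∀ k a b → (n ∸ 2) , k ≋h a → (n ∸ 3) , k ≋h b → n , suc k ≋h (a + b))
proposition7 (suc (suc (suc m))) 6≤n = no-max-vertices , max-cube-count
  where
  open PendantTail (even (3 + m)) (IsFilter m) (IsFilter (suc m)) (IsFilter (3 + m))
    (proj₁ (S-fence-tail m 6≤n)) (proj₂ (S-fence-tail m 6≤n))
proposition7 (suc zero)          (s≤s ())
proposition7 (suc (suc zero))    (s≤s (s≤s ()))
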